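{- Let $q$ be a positive integer and let $b_i=\binom{i}{q}$ for $i=1,2,\ldots$. Then for all integers $n\ge2$, \[C^{(\mathbf b)}(n+q+1)=\sum_{i=0}^{q}(-1)^{i+q}\binom{q+1}{i}C^{(\mathbf b)}(n+i)+C^{(\mathbf b)}(n+1).\]
   Context: Given a sequence $\mathbf b=(b_1,b_2,\ldots)$ of nonnegative integers and positive integers $n,k$, $C^{(\mathbf b)}(n,k)=\sum b_{i_1}\cdots b_{i_k}$, the sum over all $k$-tuples of positive integers with sum $n$ (number of compositions of $n$ with $k$ parts where a part equal to $j$ comes in $b_j$ types), and $C^{(\mathbf b)}(n)=\sum_{k=1}^nC^{(\mathbf b)}(n,k)$. Binomial coefficients $\binom{a}{b}$ are $0$ when $a<b$. -}

module Defs where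

open import Data.Nat using (ℕ; zero; suc; _+_; _*_; _∸_)
open import Data.Nat.Combinatorics using (_C_)
open import Data.List using (List; []; _∷_; map; foldr)
open import Data.Nat.ListAction using (sum)
open import Data.Integer using (ℤ) renaming (_+_ to _+ℤ_; 0ℤ to 0ℤ)

range1 : ℕ → List ℕ
range1 zero = []
range1 (suc n) = suc n ∷ range1 n

range0 : ℕ → List ℕ
range0 zero = zero ∷ []
range0 (suc n) = suc n ∷ range0 n

-- Cbnk b n k = Σ b_{i_1} ⋯ b_{i_k} over k-tuples (i_1,…,i_k) of positive
-- integers with i_1 + ⋯ + i_k = n.  Defined by splitting off the first part
-- i_1 = j ∈ {1,…,n}; the empty tuple has sum 0 and empty product 1.
-- (Only the values b 1, b 2, … are ever used.)
Cbnk : (ℕ → ℕ) → ℕ → ℕ → ℕ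
Cbnk b zero zero = 1
Cbnk b (suc n) zero = 0
Cbnk b n (suc k) = sum (map (λ j → b j * Cbnk b (n ∸ j) k) (range1 n))

Cb : (ℕ → ℕ) → ℕ → ℕ
Cb b n = sum (map (Cbnk b n) (range1 n))

binomSeq : ℕ → ℕ → ℕ
binomSeq q i = i C q

sumℤ : List ℤ → ℤ
sumℤ = foldr _+ℤ_ 0ℤ

module Submission where

-- Work with integer sequences g : ℕ → ℤ and three operations on
-- them: the shift  (↑ g)(m) = g(m-1)  (with ↑ g 0 = 0), the backward
-- difference  Δ g = g - ↑ g,  and the truncated convolution
-- (b ⋆ g)(m) = Σ_{j ≤ m} b(j) g(m-j).
--
--  1. Splitting a composition after its first part gives  F = B ⋆ T,  where
--     F(m) = C^{(b)}(m), T(m) = Σ_{k ≤ m} C^{(b)}(m,k) (so T = F except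
--     T(0) = 1), and B(j) = b_j; this needs b_0 = 0, i.e. q ≥ 1.
--  2. Shift and difference act on the left factor of a convolution, hence
--     Δ^{q+1} F = (Δ^{q+1} B) ⋆ T.
--  3. By Pascal's rule Δ B_{q+1} = ↑ B_q for B_q(j) = binom(j,q), whence
--     Δ^{q+1} B_q = ↑^q δ and  Δ^{q+1} F (n+q+1) = T(n+1) = F(n+1).
--  4. Expanding Δ^{r} by the binomial theorem,
--     Δ^{r} g (m+r) = Σ_{j ≤ r} (-1)^{j+r} binom(r,j) g(m+j);
--     isolating the term j = q+1 for r = q+1 gives the proposition.

open import Defs
open import Data.Nat using (ℕ; zero; suc; _+_; _*_; _∸_; _<_; _≤_; _≥_; s≤s)
import Data.Nat.Properties as ℕP
open import Data.Nat.Combinatorics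
  using (_C_; nCk+nC[k+1]≡[n+1]C[k+1]; k>n⇒nCk≡0; nCn≡1)
open import Data.Nat.ListAction using (sum)
open import Data.Integer using (ℤ; +_; 0ℤ; 1ℤ; -1ℤ; -_)
  renaming (_+_ to _+ℤ_; _-_ to _-ℤ_; _*_ to _*ℤ_; _^_ to _^ℤ_)
import Data.Integer.Properties as ℤP
open import Data.Integer.Tactic.RingSolver using (solve-∀)
open import Data.List using (map)
open import Data.Sum using (inj₁; inj₂)
open import Function using (_∘_)
open import Relation.Binary.PropositionalEquality
  using (_≡_; _≗_; refl; sym; trans; cong; cong₂; module ≡-Reasoning)

open ≡-Reasoning

difference-isolate : ∀ a b {c} → a -ℤ b ≡ c → a ≡ b +ℤ c
difference-isolate a b e = trans (rearrange a b) (cong (b +ℤ_) e)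
  where
  rearrange : ∀ a b → a ≡ b +ℤ (a -ℤ b)
  rearrange = solve-∀

*-distribʳ-sub : ∀ c a b → (a -ℤ b) *ℤ c ≡ a *ℤ c -ℤ b *ℤ c
*-distribʳ-sub = solve-∀

Seq : Set
Seq = ℕ → ℤ

∑ : ℕ → Seq → ℤ
∑ zero    h = 0ℤ
∑ (suc n) h = h n +ℤ ∑ n h

∑-cong : ∀ n {h g : Seq} → h ≗ g → ∑ n h ≡ ∑ n g
∑-cong zero    h≗g = refl
∑-cong (suc n) h≗g = cong₂ _+ℤ_ (h≗g n) (∑-cong n h≗g)

∑-zero : ∀ n {h : Seq} → h ≗ (λ _ → 0ℤ) → ∑ n h ≡ 0ℤ
∑-zero zero    h≗0 = refl
∑-zero (suc n) h≗0 = cong₂ _+ℤ_ (h≗0 n) (∑-zero n h≗0)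

∑-+ : ∀ n (h g : Seq) → ∑ n (λ i → h i +ℤ g i) ≡ ∑ n h +ℤ ∑ n g
∑-+ zero    h g = refl
∑-+ (suc n) h g = trans (cong (h n +ℤ g n +ℤ_) (∑-+ n h g))
                        (interchange (h n) (g n) (∑ n h) (∑ n g))
  where
  interchange : ∀ a b c d → (a +ℤ b) +ℤ (c +ℤ d) ≡ (a +ℤ c) +ℤ (b +ℤ d)
  interchange = solve-∀

∑-neg : ∀ n (h : Seq) → ∑ n (λ i → - h i) ≡ - ∑ n h
∑-neg zero    h = refl
∑-neg (suc n) h = trans (cong (- h n +ℤ_) (∑-neg n h))
                        (sym (ℤP.neg-distrib-+ (h n) (∑ n h)))

∑-- : ∀ n (h g : Seq) → ∑ n (λ i → h i -ℤ g i) ≡ ∑ n h -ℤ ∑ n g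
∑-- n h g = trans (∑-+ n h (λ i → - g i)) (cong (∑ n h +ℤ_) (∑-neg n g))

∑-*ˡ : ∀ n c (h : Seq) → ∑ n (λ i → c *ℤ h i) ≡ c *ℤ ∑ n h
∑-*ˡ zero    c h = sym (ℤP.*-zeroʳ c)
∑-*ˡ (suc n) c h = trans (cong (c *ℤ h n +ℤ_) (∑-*ˡ n c h))
                         (sym (ℤP.*-distribˡ-+ c (h n) (∑ n h)))

∑-head : ∀ n (h : Seq) → ∑ (suc n) h ≡ h 0 +ℤ ∑ n (h ∘ suc)
∑-head zero    h = refl
∑-head (suc n) h = trans (cong (h (suc n) +ℤ_) (∑-head n h))
                         (left-comm (h (suc n)) (h 0) _)
  where
  left-comm : ∀ a b c → a +ℤ (b +ℤ c) ≡ b +ℤ (a +ℤ c)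
  left-comm = solve-∀

∑-swap : ∀ n m (h : ℕ → ℕ → ℤ) →
         ∑ n (λ i → ∑ m (h i)) ≡ ∑ m (λ j → ∑ n (λ i → h i j))
∑-swap zero    m h = sym (∑-zero m (λ _ → refl))
∑-swap (suc n) m h = trans (cong (∑ m (h n) +ℤ_) (∑-swap n m h))
                           (sym (∑-+ m (h n) _))

cast-range1 : ∀ n (h : ℕ → ℕ) → + sum (map h (range1 n)) ≡ ∑ n (λ i → + h (suc i))
cast-range1 zero    h = refl
cast-range1 (suc n) h = trans (ℤP.pos-+ (h (suc n)) _)
                              (cong (+ h (suc n) +ℤ_) (cast-range1 n h))

sumℤ-range0 : ∀ n (h : Seq) → sumℤ (map h (range0 n)) ≡ ∑ (suc n) h
sumℤ-range0 zero    h = refl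
sumℤ-range0 (suc n) h = cong (h (suc n) +ℤ_) (sumℤ-range0 n h)

-- Shift, difference, convolution and iterated operators

Congruent : (Seq → Seq) → Set
Congruent Φ = ∀ {f g} → f ≗ g → Φ f ≗ Φ g

power : ℕ → (Seq → Seq) → Seq → Seq
power zero    Φ g = g
power (suc r) Φ g = Φ (power r Φ g)

power-cong : ∀ r (Φ : Seq → Seq) → Congruent Φ → Congruent (power r Φ)
power-cong zero    Φ Φ-cong f≗g = f≗g
power-cong (suc r) Φ Φ-cong f≗g = Φ-cong (power-cong r Φ Φ-cong f≗g)

power-commute : ∀ r (Φ Ψ : Seq → Seq) → Congruent Φ → (∀ g → Φ (Ψ g) ≗ Ψ (Φ g)) →
                ∀ g → power r Φ (Ψ g) ≗ Ψ (power r Φ g)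
power-commute zero    Φ Ψ Φ-cong comm g m = refl
power-commute (suc r) Φ Ψ Φ-cong comm g m =
  trans (Φ-cong (power-commute r Φ Ψ Φ-cong comm g) m) (comm (power r Φ g) m)

↑ : Seq → Seq
↑ g zero    = 0ℤ
↑ g (suc m) = g m

Δ : Seq → Seq
Δ g m = g m -ℤ ↑ g m

↑-cong : Congruent ↑
↑-cong f≗g zero    = refl
↑-cong f≗g (suc m) = f≗g m

Δ-cong : Congruent Δ
Δ-cong f≗g m = cong₂ _-ℤ_ (f≗g m) (↑-cong f≗g m)

Δ-↑ : ∀ g → Δ (↑ g) ≗ ↑ (Δ g)
Δ-↑ g zero    = refl
Δ-↑ g (suc m) = refl

power-↑ : ∀ q g m → power q ↑ g (m + q) ≡ g m
power-↑ zero    g m = cong g (ℕP.+-identityʳ m)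
power-↑ (suc q) g m = trans (cong (↑ (power q ↑ g)) (ℕP.+-suc m q)) (power-↑ q g m)

_⋆_ : Seq → Seq → Seq
(b ⋆ g) m = ∑ (suc m) (λ j → b j *ℤ g (m ∸ j))

⋆-congˡ : ∀ {b c} g → b ≗ c → b ⋆ g ≗ c ⋆ g
⋆-congˡ g b≗c m = ∑-cong (suc m) (λ j → cong (_*ℤ g (m ∸ j)) (b≗c j))

δ : Seq
δ zero    = 1ℤ
δ (suc _) = 0ℤ

δ-⋆ : ∀ g → δ ⋆ g ≗ g
δ-⋆ g m = begin
  ∑ (suc m) (λ j → δ j *ℤ g (m ∸ j))          ≡⟨ ∑-head m (λ j → δ j *ℤ g (m ∸ j)) ⟩
  1ℤ *ℤ g m +ℤ ∑ m (λ j → 0ℤ *ℤ g (m ∸ suc j)) ≡⟨ cong (1ℤ *ℤ g m +ℤ_) (∑-zero m (λ _ → refl)) ⟩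
  1ℤ *ℤ g m +ℤ 0ℤ                              ≡⟨ ℤP.+-identityʳ _ ⟩
  1ℤ *ℤ g m                                    ≡⟨ ℤP.*-identityˡ _ ⟩
  g m                                          ∎

↑-⋆ : ∀ b g → ↑ (b ⋆ g) ≗ ↑ b ⋆ g
↑-⋆ b g zero    = refl
↑-⋆ b g (suc m) = sym (trans (∑-head (suc m) (λ j → ↑ b j *ℤ g (suc m ∸ j))) (ℤP.+-identityˡ _))

Δ-⋆ : ∀ b g → Δ (b ⋆ g) ≗ Δ b ⋆ g
Δ-⋆ b g m = begin
  (b ⋆ g) m -ℤ ↑ (b ⋆ g) m
    ≡⟨ cong ((b ⋆ g) m -ℤ_) (↑-⋆ b g m) ⟩
  (b ⋆ g) m -ℤ (↑ b ⋆ g) m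
    ≡⟨ ∑-- (suc m) (λ j → b j *ℤ g (m ∸ j)) (λ j → ↑ b j *ℤ g (m ∸ j)) ⟨
  ∑ (suc m) (λ j → b j *ℤ g (m ∸ j) -ℤ ↑ b j *ℤ g (m ∸ j))
    ≡⟨ ∑-cong (suc m) (λ j → sym (*-distribʳ-sub (g (m ∸ j)) (b j) (↑ b j))) ⟩
  (Δ b ⋆ g) m ∎

power-⋆ : ∀ r (Φ : Seq → Seq) → Congruent Φ → (∀ b g → Φ (b ⋆ g) ≗ Φ b ⋆ g) →
          ∀ b g → power r Φ (b ⋆ g) ≗ power r Φ b ⋆ g
power-⋆ zero    Φ Φ-cong Φ-⋆ b g m = refl
power-⋆ (suc r) Φ Φ-cong Φ-⋆ b g m =
  trans (Φ-cong (power-⋆ r Φ Φ-cong Φ-⋆ b g) m) (Φ-⋆ (power r Φ b) g m)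

-- Differences of binomial sequences

binom : ℕ → Seq
binom q j = + (j C q)

pascal : ∀ r j → + (suc r C suc j) ≡ + (r C j) +ℤ + (r C suc j)
pascal r j = trans (cong +_ (sym (nCk+nC[k+1]≡[n+1]C[k+1] r j))) (ℤP.pos-+ (r C j) (r C suc j))

Δ-binom-suc : ∀ q → Δ (binom (suc q)) ≗ ↑ (binom q)
Δ-binom-suc q zero    = refl
Δ-binom-suc q (suc j) = trans (cong (_-ℤ binom (suc q) j) (pascal j q))
                              (cancel (binom q j) (binom (suc q) j))
  where
  cancel : ∀ a b → (a +ℤ b) -ℤ b ≡ a
  cancel = solve-∀

Δ-binom-zero : Δ (binom 0) ≗ δ
Δ-binom-zero zero    = refl
Δ-binom-zero (suc j) = refl

Δ-power-binom : ∀ q → power (suc q) Δ (binom q) ≗ power q ↑ δ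
Δ-power-binom zero = Δ-binom-zero
Δ-power-binom (suc q) m = begin
  Δ (power (suc q) Δ (binom (suc q))) m
    ≡⟨ power-commute (suc q) Δ Δ Δ-cong (λ _ _ → refl) (binom (suc q)) m ⟨
  power (suc q) Δ (Δ (binom (suc q))) m
    ≡⟨ power-cong (suc q) Δ Δ-cong (Δ-binom-suc q) m ⟩
  power (suc q) Δ (↑ (binom q)) m
    ≡⟨ power-commute (suc q) Δ ↑ Δ-cong Δ-↑ (binom q) m ⟩
  ↑ (power (suc q) Δ (binom q)) m
    ≡⟨ ↑-cong (Δ-power-binom q) m ⟩
  ↑ (power q ↑ δ) m ∎

-- Binomial expansion of iterated differences

sgn : ℕ → ℤ
sgn k = -1ℤ ^ℤ k

sgn-suc : ∀ k → sgn (suc k) ≡ - sgn k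
sgn-suc k = ℤP.-1*i≡-i (sgn k)

sgn-double : ∀ k → sgn (k + k) ≡ 1ℤ
sgn-double zero    = refl
sgn-double (suc k) = begin
  sgn (suc k + suc k)   ≡⟨ cong (sgn ∘ suc) (ℕP.+-suc k k) ⟩
  sgn (suc (suc (k + k))) ≡⟨ sgn-suc (suc (k + k)) ⟩
  - sgn (suc (k + k))   ≡⟨ cong -_ (sgn-suc (k + k)) ⟩
  - - sgn (k + k)       ≡⟨ ℤP.neg-involutive _ ⟩
  sgn (k + k)           ≡⟨ sgn-double k ⟩
  1ℤ                    ∎

-- The coefficient (-1)^{j+r} binom(r,j) of g(m+j) in Δ^r g (m+r).
coeff : ℕ → ℕ → ℤ
coeff r j = sgn (j + r) *ℤ + (r C j)

coeff-zero : ∀ r → coeff (suc r) 0 ≡ - coeff r 0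
coeff-zero r = trans (cong (_*ℤ 1ℤ) (sgn-suc r)) (sym (ℤP.neg-distribˡ-* (sgn r) 1ℤ))

coeff-pascal : ∀ r j → coeff (suc r) (suc j) ≡ coeff r j -ℤ coeff r (suc j)
coeff-pascal r j = begin
  sgn (suc j + suc r) *ℤ + (suc r C suc j)
    ≡⟨ cong₂ _*ℤ_ sign (pascal r j) ⟩
  - - s *ℤ (+ (r C j) +ℤ + (r C suc j))
    ≡⟨ distribute s (+ (r C j)) (+ (r C suc j)) ⟩
  s *ℤ + (r C j) -ℤ - s *ℤ + (r C suc j)
    ≡⟨ cong (λ t → coeff r j -ℤ t *ℤ + (r C suc j)) (sgn-suc (j + r)) ⟨
  coeff r j -ℤ coeff r (suc j) ∎
  where
  s : ℤ
  s = sgn (j + r)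
  sign : sgn (suc j + suc r) ≡ - - s
  sign = trans (cong (sgn ∘ suc) (ℕP.+-suc j r))
               (trans (sgn-suc (suc (j + r))) (cong -_ (sgn-suc (j + r))))
  distribute : ∀ s a b → - - s *ℤ (a +ℤ b) ≡ s *ℤ a -ℤ - s *ℤ b
  distribute = solve-∀

coeff-beyond : ∀ r → coeff r (suc r) ≡ 0ℤ
coeff-beyond r = trans (cong (λ t → sgn (suc r + r) *ℤ + t) (k>n⇒nCk≡0 (ℕP.n<1+n r)))
                       (ℤP.*-zeroʳ (sgn (suc r + r)))

coeff-diagonal : ∀ r → coeff r r ≡ 1ℤ
coeff-diagonal r = cong₂ (λ s t → s *ℤ + t) (sgn-double r) (nCn≡1 r)

expansion : ℕ → Seq → ℤ
expansion r h = ∑ (suc r) (λ j → coeff r j *ℤ h j)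

-- Pascal's rule for the combinations: they satisfy the recursion of Δ.
expansion-suc : ∀ r h → expansion (suc r) h ≡ expansion r (h ∘ suc) -ℤ expansion r h
expansion-suc r h = begin
  expansion (suc r) h
    ≡⟨ ∑-head (suc r) (λ j → coeff (suc r) j *ℤ h j) ⟩
  coeff (suc r) 0 *ℤ h 0 +ℤ ∑ (suc r) (λ j → coeff (suc r) (suc j) *ℤ h (suc j))
    ≡⟨ cong₂ _+ℤ_ (cong (_*ℤ h 0) (coeff-zero r)) (∑-cong (suc r) split) ⟩
  - coeff r 0 *ℤ h 0 +ℤ ∑ (suc r) (λ j → coeff r j *ℤ h (suc j) -ℤ tail j)
    ≡⟨ cong (- coeff r 0 *ℤ h 0 +ℤ_) (∑-- (suc r) (λ j → coeff r j *ℤ h (suc j)) tail) ⟩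
  - coeff r 0 *ℤ h 0 +ℤ (expansion r (h ∘ suc) -ℤ ∑ (suc r) tail)
    ≡⟨ regroup (coeff r 0) (h 0) (expansion r (h ∘ suc)) (∑ (suc r) tail) ⟩
  expansion r (h ∘ suc) -ℤ (coeff r 0 *ℤ h 0 +ℤ ∑ (suc r) tail)
    ≡⟨ cong (expansion r (h ∘ suc) -ℤ_) (∑-head (suc r) (λ j → coeff r j *ℤ h j)) ⟨
  expansion r (h ∘ suc) -ℤ (coeff r (suc r) *ℤ h (suc r) +ℤ expansion r h)
    ≡⟨ cong (λ t → expansion r (h ∘ suc) -ℤ (t *ℤ h (suc r) +ℤ expansion r h)) (coeff-beyond r) ⟩
  expansion r (h ∘ suc) -ℤ (0ℤ *ℤ h (suc r) +ℤ expansion r h)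
    ≡⟨ cong (expansion r (h ∘ suc) -ℤ_) (ℤP.+-identityˡ _) ⟩
  expansion r (h ∘ suc) -ℤ expansion r h ∎
  where
  tail : Seq
  tail j = coeff r (suc j) *ℤ h (suc j)
  split : ∀ j → coeff (suc r) (suc j) *ℤ h (suc j) ≡ coeff r j *ℤ h (suc j) -ℤ tail j
  split j = trans (cong (_*ℤ h (suc j)) (coeff-pascal r j))
                  (*-distribʳ-sub (h (suc j)) (coeff r j) (coeff r (suc j)))
  regroup : ∀ c x e t → - c *ℤ x +ℤ (e -ℤ t) ≡ e -ℤ (c *ℤ x +ℤ t)
  regroup = solve-∀

-- Separating the leading term j = r+1, whose coefficient is 1; the other
-- coefficients are those of the proposition with the opposite sign.
expansion-top : ∀ r h → expansion (suc r) h ≡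
                h (suc r) -ℤ ∑ (suc r) (λ j → sgn (j + r) *ℤ + (suc r C j) *ℤ h j)
expansion-top r h = cong₂ _+ℤ_
  (trans (cong (_*ℤ h (suc r)) (coeff-diagonal (suc r))) (ℤP.*-identityˡ (h (suc r))))
  (trans (∑-cong (suc r) lower-coeff) (∑-neg (suc r) (λ j → sgn (j + r) *ℤ + (suc r C j) *ℤ h j)))
  where
  lower-coeff : ∀ j → coeff (suc r) j *ℤ h j ≡ - (sgn (j + r) *ℤ + (suc r C j) *ℤ h j)
  lower-coeff j = begin
    sgn (j + suc r) *ℤ + (suc r C j) *ℤ h j
      ≡⟨ cong (λ s → s *ℤ + (suc r C j) *ℤ h j) (trans (cong sgn (ℕP.+-suc j r)) (sgn-suc (j + r))) ⟩
    - sgn (j + r) *ℤ + (suc r C j) *ℤ h j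
      ≡⟨ negate (sgn (j + r)) (+ (suc r C j)) (h j) ⟩
    - (sgn (j + r) *ℤ + (suc r C j) *ℤ h j) ∎
    where
    negate : ∀ s c x → - s *ℤ c *ℤ x ≡ - (s *ℤ c *ℤ x)
    negate = solve-∀

Δ-power-expansion : ∀ r g m → power r Δ g (m + r) ≡ expansion r (λ j → g (m + j))
Δ-power-expansion zero g m = sym (trans (ℤP.+-identityʳ _) (ℤP.*-identityˡ _))
Δ-power-expansion (suc r) g m = begin
  Δ (power r Δ g) (m + suc r)
    ≡⟨ cong (Δ (power r Δ g)) (ℕP.+-suc m r) ⟩
  power r Δ g (suc m + r) -ℤ power r Δ g (m + r)
    ≡⟨ cong₂ _-ℤ_ (Δ-power-expansion r g (suc m)) (Δ-power-expansion r g m) ⟩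
  expansion r (λ j → g (suc m + j)) -ℤ expansion r (λ j → g (m + j))
    ≡⟨ cong (_-ℤ expansion r (λ j → g (m + j)))
            (∑-cong (suc r) (λ j → cong (λ t → coeff r j *ℤ g t) (sym (ℕP.+-suc m j)))) ⟩
  expansion r (λ j → g (m + suc j)) -ℤ expansion r (λ j → g (m + j))
    ≡⟨ expansion-suc r (λ j → g (m + j)) ⟨
  expansion (suc r) (λ j → g (m + j)) ∎

-- The first-part recursion for compositions

sum-range1-zero : ∀ n (h : ℕ → ℕ) → (∀ i → h (suc i) ≡ 0) → sum (map h (range1 n)) ≡ 0
sum-range1-zero zero    h h≡0 = refl
sum-range1-zero (suc n) h h≡0 = cong₂ _+_ (h≡0 n) (sum-range1-zero n h h≡0)

-- A composition of m has at most m parts.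
Cbnk-vanish : ∀ b k m → m < k → Cbnk b m k ≡ 0
Cbnk-vanish b (suc k) zero    _         = refl
Cbnk-vanish b (suc k) (suc m) (s≤s m<k) = sum-range1-zero (suc m) _ (λ i →
  trans (cong (b (suc i) *_) (Cbnk-vanish b k (m ∸ i) (ℕP.≤-<-trans (ℕP.m∸n≤m m i) m<k)))
        (ℕP.*-zeroʳ (b (suc i))))

module Compositions (b : ℕ → ℕ) where

  B F : Seq
  B j = + b j
  F m = + Cb b m

  -- T m = Σ_{k ≤ m} C^{(b)}(m,k): compositions of m with any number of
  -- parts, so T 0 = 1 counts the empty composition.
  T : Seq
  T m = ∑ (suc m) (λ k → + Cbnk b m k)

  T-suc : ∀ m → T (suc m) ≡ F (suc m)
  T-suc m = trans (∑-head (suc m) (λ k → + Cbnk b (suc m) k)) (trans (ℤP.+-identityˡ _) (sym (cast-range1 (suc m) _)))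

  T-extend : ∀ m N → m ≤ N → ∑ (suc N) (λ k → + Cbnk b m k) ≡ T m
  T-extend m N m≤N with ℕP.m≤n⇒m<n∨m≡n m≤N
  ... | inj₂ refl = refl
  T-extend m (suc N) _ | inj₁ (s≤s m≤N) =
    trans (cong (λ t → + t +ℤ ∑ (suc N) (λ k → + Cbnk b m k)) (Cbnk-vanish b (suc N) m (s≤s m≤N)))
          (trans (ℤP.+-identityˡ _) (T-extend m N m≤N))

  first-part : ∀ n k → + Cbnk b (suc n) (suc k) ≡ ∑ (suc n) (λ j → B (suc j) *ℤ + Cbnk b (n ∸ j) k)
  first-part n k = trans (cast-range1 (suc n) _)
                         (∑-cong (suc n) (λ j → ℤP.pos-* (b (suc j)) (Cbnk b (n ∸ j) k)))

  F≗B⋆T : b 0 ≡ 0 → F ≗ B ⋆ T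
  F≗B⋆T b0≡0 zero    = cong (λ t → + t *ℤ 1ℤ +ℤ 0ℤ) (sym b0≡0)
  F≗B⋆T b0≡0 (suc n) = begin
    F (suc n)
      ≡⟨ cast-range1 (suc n) _ ⟩
    ∑ (suc n) (λ k → + Cbnk b (suc n) (suc k))
      ≡⟨ ∑-cong (suc n) (first-part n) ⟩
    ∑ (suc n) (λ k → ∑ (suc n) (λ j → B (suc j) *ℤ + Cbnk b (n ∸ j) k))
      ≡⟨ ∑-swap (suc n) (suc n) (λ k j → B (suc j) *ℤ + Cbnk b (n ∸ j) k) ⟩
    ∑ (suc n) (λ j → ∑ (suc n) (λ k → B (suc j) *ℤ + Cbnk b (n ∸ j) k))
      ≡⟨ ∑-cong (suc n) (λ j → ∑-*ˡ (suc n) (B (suc j)) (λ k → + Cbnk b (n ∸ j) k)) ⟩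
    ∑ (suc n) (λ j → B (suc j) *ℤ ∑ (suc n) (λ k → + Cbnk b (n ∸ j) k))
      ≡⟨ ∑-cong (suc n) (λ j → cong (B (suc j) *ℤ_) (T-extend (n ∸ j) n (ℕP.m∸n≤m n j))) ⟩
    ∑ (suc n) (λ j → B (suc j) *ℤ T (n ∸ j))
      ≡⟨ ℤP.+-identityˡ _ ⟨
    0ℤ +ℤ ∑ (suc n) (λ j → B (suc j) *ℤ T (n ∸ j))
      ≡⟨ cong (λ t → + t *ℤ T (suc n) +ℤ ∑ (suc n) (λ j → B (suc j) *ℤ T (n ∸ j))) b0≡0 ⟨
    B 0 *ℤ T (suc n) +ℤ ∑ (suc n) (λ j → B (suc j) *ℤ T (n ∸ j))
      ≡⟨ ∑-head (suc n) (λ j → B j *ℤ T (suc n ∸ j)) ⟨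
    (B ⋆ T) (suc n) ∎

Δ-power-Cb : ∀ q → q ≥ 1 → ∀ n →
             power (suc q) Δ (λ m → + Cb (binomSeq q) m) (n + suc q) ≡ + Cb (binomSeq q) (suc n)
Δ-power-Cb q q≥1 n = begin
  power (suc q) Δ F (n + suc q)
    ≡⟨ power-cong (suc q) Δ Δ-cong (F≗B⋆T (k>n⇒nCk≡0 q≥1)) _ ⟩
  power (suc q) Δ (B ⋆ T) (n + suc q)
    ≡⟨ power-⋆ (suc q) Δ Δ-cong Δ-⋆ B T _ ⟩
  (power (suc q) Δ B ⋆ T) (n + suc q)
    ≡⟨ ⋆-congˡ T (Δ-power-binom q) _ ⟩
  (power q ↑ δ ⋆ T) (n + suc q)
    ≡⟨ power-⋆ q ↑ ↑-cong ↑-⋆ δ T _ ⟨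
  power q ↑ (δ ⋆ T) (n + suc q)
    ≡⟨ power-cong q ↑ ↑-cong (δ-⋆ T) _ ⟩
  power q ↑ T (n + suc q)
    ≡⟨ cong (power q ↑ T) (ℕP.+-suc n q) ⟩
  power q ↑ T (suc n + q)
    ≡⟨ power-↑ q T (suc n) ⟩
  T (suc n)
    ≡⟨ T-suc n ⟩
  F (suc n) ∎
  where open Compositions (binomSeq q)

proposition12 : (q : ℕ) → q ≥ 1 → (n : ℕ) → n ≥ 2 →
    + Cb (binomSeq q) (n + q + 1)
      ≡ sumℤ (map (λ i → (-1ℤ ^ℤ (i + q)) *ℤ (+ ((q + 1) C i)) *ℤ (+ Cb (binomSeq q) (n + i))) (range0 q))
        +ℤ (+ Cb (binomSeq q) (n + 1))
proposition12 q q≥1 n _ = begin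
  F (n + q + 1)
    ≡⟨ cong F (trans (ℕP.+-assoc n q 1) (cong (λ t → n + t) (ℕP.+-comm q 1))) ⟩
  F (n + suc q)
    ≡⟨ difference-isolate (F (n + suc q)) (∑ (suc q) (lower (suc q))) expanded ⟩
  ∑ (suc q) (lower (suc q)) +ℤ F (suc n)
    ≡⟨ cong₂ _+ℤ_ (trans (∑-cong (suc q) (λ i → cong (λ t → lower t i) (ℕP.+-comm 1 q)))
                         (sym (sumℤ-range0 q (lower (q + 1)))))
                  (cong F (ℕP.+-comm 1 n)) ⟩
  sumℤ (map (lower (q + 1)) (range0 q)) +ℤ F (n + 1) ∎
  where
  F : Seq
  F m = + Cb (binomSeq q) m
  lower : ℕ → Seq
  lower c i = sgn (i + q) *ℤ + (c C i) *ℤ F (n + i)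
  expanded : F (n + suc q) -ℤ ∑ (suc q) (lower (suc q)) ≡ F (suc n)
  expanded = begin
    F (n + suc q) -ℤ ∑ (suc q) (lower (suc q))   ≡⟨ expansion-top q (λ j → F (n + j)) ⟨
    expansion (suc q) (λ j → F (n + j))          ≡⟨ Δ-power-expansion (suc q) F n ⟨
    power (suc q) Δ F (n + suc q)                ≡⟨ Δ-power-Cb q q≥1 n ⟩
    F (suc n)                                    ∎
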